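{- Let $q$ be a prime power, $n\ge 1$, and let $\sigma:x\mapsto x^{q^m}$ be an automorphism of $\mathbb{F}_{q^n}$ with $\gcd(m,n)=1$. Let $A=\begin{pmatrix} a & b\\ c& d\end{pmatrix}$ be a nonzero $2\times 2$ matrix over $\mathbb{F}_{q^n}$, and let $\Gamma$ be the set of points $X=(x_1,x_2)$ of $\mathrm{PG}(1,q^n)$ satisfying $X_tAX^\sigma=0$, i.e. $(ax_1+cx_2)x_1^\sigma+(bx_1+dx_2)x_2^\sigma=0$ (the set of absolute points of the, possibly degenerate, correlation induced by the $\sigma$-sesquilinear form $\langle x,y\rangle=X_tAY^\sigma$ on $\mathbb{F}_{q^n}^2$). Then $\Gamma$ is one of the following: the empty set; a single point; two points; the point set of an $\mathbb{F}_q$-subline $\mathrm{PG}(1,q)$ of $\mathrm{PG}(1,q^n)$.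
   Context: $X_t$ denotes the transpose of the coordinate column $X$, and $X^\sigma$ means $\sigma$ applied entrywise. A $\sigma$-sesquilinear form on $V$ is linear in the first argument and $\sigma$-semilinear in the second. An $\mathbb{F}_q$-subline of $\mathrm{PG}(1,q^n)$ is the image under a projectivity of $\mathrm{PG}(1,q^n)$ of the set of points with coordinates in $\mathbb{F}_q$. -}

module Defs where

open import Level using (Level; _⊔_)
open import Algebra.Bundles using (CommutativeRing)
open import Data.Nat using (ℕ; zero; suc)
open import Data.Fin using (Fin)
open import Data.Product using (Σ; ∃; _×_; _,_)
open import Data.Sum using (_⊎_)
open import Relation.Nullary using (¬_)
open import Relation.Binary.PropositionalEquality using (_≡_)
open import Function.Bundles using (_⇔_)

open import Data.Nat.Primality using (Prime)
import Data.Nat as N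

IsPrimePower : ℕ → Set
IsPrimePower q = Σ ℕ λ p → Σ ℕ λ k → Prime p × (1 N.≤ k) × (q ≡ p N.^ k)

module FieldDefs {c ℓ : Level} (R : CommutativeRing c ℓ) where
  open CommutativeRing R

  IsField : Set (c ⊔ ℓ)
  IsField = (¬ (1# ≈ 0#)) × (∀ x → ¬ (x ≈ 0#) → ∃ λ y → x * y ≈ 1#)

  HasCardinality : ℕ → Set (c ⊔ ℓ)
  HasCardinality N = Σ (Fin N → Carrier) λ f →
    (∀ i j → f i ≈ f j → i ≡ j) × (∀ x → ∃ λ i → f i ≈ x)

  pow : Carrier → ℕ → Carrier
  pow x zero = 1#
  pow x (suc k) = x * pow x k

  Vec2 : Set c
  Vec2 = Carrier × Carrier

  NonZeroVec : Vec2 → Set ℓ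
  NonZeroVec (x₁ , x₂) = ¬ ((x₁ ≈ 0#) × (x₂ ≈ 0#))

  SamePoint : Vec2 → Vec2 → Set (c ⊔ ℓ)
  SamePoint (x₁ , x₂) (y₁ , y₂) =
    ∃ λ t → (¬ (t ≈ 0#)) × (y₁ ≈ t * x₁) × (y₂ ≈ t * x₂)

  record Mat2 : Set c where
    constructor mat
    field
      m11 m12 m21 m22 : Carrier

  NonZeroMat : Mat2 → Set ℓ
  NonZeroMat (mat a b c' d) =
    ¬ ((a ≈ 0#) × (b ≈ 0#) × (c' ≈ 0#) × (d ≈ 0#))

  det : Mat2 → Carrier
  det (mat a b c' d) = a * d - b * c'

  apply : Mat2 → Vec2 → Vec2
  apply (mat a b c' d) (x₁ , x₂) = (a * x₁ + b * x₂ , c' * x₁ + d * x₂)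

  Absolute : (Carrier → Carrier) → Mat2 → Vec2 → Set ℓ
  Absolute σ (mat a b c' d) (x₁ , x₂) =
    (a * x₁ + c' * x₂) * σ x₁ + (b * x₁ + d * x₂) * σ x₂ ≈ 0#

  -- the set Γ of points of PG(1,F), as a predicate on nonzero representatives
  -- (it is invariant under SamePoint)
  Γ : (Carrier → Carrier) → Mat2 → Vec2 → Set ℓ
  Γ σ A X = NonZeroVec X × Absolute σ A X

  IsEmptySet : (Vec2 → Set ℓ) → Set (c ⊔ ℓ)
  IsEmptySet S = ∀ X → ¬ S X

  IsSinglePoint : (Vec2 → Set ℓ) → Set (c ⊔ ℓ)
  IsSinglePoint S = ∃ λ P → S P × (∀ X → S X → SamePoint P X)

  IsTwoPoints : (Vec2 → Set ℓ) → Set (c ⊔ ℓ)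
  IsTwoPoints S = ∃ λ P → ∃ λ Q → S P × S Q × (¬ SamePoint P Q) ×
    (∀ X → S X → SamePoint P X ⊎ SamePoint Q X)

  -- elements of the subfield F_q : fixed points of x ↦ x^q
  InSubfield : ℕ → Carrier → Set ℓ
  InSubfield q x = pow x q ≈ x

  StdSublineVec : ℕ → Vec2 → Set ℓ
  StdSublineVec q (y₁ , y₂) = NonZeroVec (y₁ , y₂) × InSubfield q y₁ × InSubfield q y₂

  -- S is (the point set of) an F_q-subline: the image of the standard subline
  -- under a projectivity given by an invertible matrix M.
  IsSubline : ℕ → (Vec2 → Set ℓ) → Set (c ⊔ ℓ)
  IsSubline q S = ∃ λ M → (¬ (det M ≈ 0#)) ×
    (∀ X → NonZeroVec X →
      (S X ⇔ (∃ λ Y → StdSublineVec q Y × SamePoint (apply M Y) X)))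

-- If Γ has three distinct points P, Q, S (otherwise it is empty, a point or two
-- points; over a finite field this case split is decidable), rescale P and Q so
-- that S = P + Q. In coordinates w with respect to (P, Q) the form becomes
-- w₁ σ(w₂) u + w₂ σ(w₁) v with u = ⟨P, Q⟩ and v = ⟨Q, P⟩, and u + v = 0 because S is
-- absolute. Either u = 0, the form vanishes identically and A ≠ 0 forces σ = id,
-- or the absolute points are exactly those with w₁ σ(w₂) = w₂ σ(w₁), i.e. with
-- w₂/w₁ fixed by σ. In both cases Γ is the image of the subline of points fixed
-- by σ, and Fix(x ↦ x^(qᵐ)) = 𝔽_q because every x satisfies x^(qⁿ) = x and
-- gcd(m, n) = 1. That σ is additive is the Frobenius identity (x + y)ᵖ = xᵖ + yᵖ.

module Submission where

open import Defs
open import Level using (Level; _⊔_)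
open import Algebra.Bundles using (CommutativeRing; Semiring)
open import Data.Nat as ℕ using (ℕ; suc)
open import Data.Nat.Primality using (Prime)
open import Relation.Binary using (Decidable)
import Algebra.Properties.CommutativeMonoid.Sum as Sum
import Algebra.Properties.CommutativeSemigroup
open import Algebra.Morphism.Structures using (module SemiringMorphisms)

module PrimeBinomial where
  open import Data.Nat
  open import Data.Nat.Properties
  open import Data.Nat.Divisibility
  open import Data.Nat.DivMod using (m/n*n≡m)
  open import Data.Nat.Primality using (Prime; euclidsLemma; ¬prime[1])
  open import Data.Nat.Combinatorics using (_C_; nCk≡n!/k![n-k]!; k![n∸k]!∣n!)
  open import Data.Sum using (inj₁; inj₂)
  open import Data.Empty using (⊥-elim)
  open import Relation.Binary.PropositionalEquality

  prime∣n!⇒prime≤n : ∀ {p} → Prime p → ∀ n → p ∣ n ! → p ≤ n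
  prime∣n!⇒prime≤n pr zero p∣1 = ⊥-elim (¬prime[1] (subst Prime (∣1⇒≡1 p∣1) pr))
  prime∣n!⇒prime≤n pr (suc n) p∣[1+n]! with euclidsLemma (suc n) (n !) pr p∣[1+n]!
  ... | inj₁ p∣1+n = ∣⇒≤ p∣1+n
  ... | inj₂ p∣n! = m≤n⇒m≤1+n (prime∣n!⇒prime≤n pr n p∣n!)

  nCk*k![n∸k]!≡n! : ∀ {n k} → k ≤ n → (n C k) * (k ! * (n ∸ k) !) ≡ n !
  nCk*k![n∸k]!≡n! {n} {k} k≤n = begin
    (n C k) * (k ! * (n ∸ k) !)           ≡⟨ cong (_* (k ! * (n ∸ k) !)) (nCk≡n!/k![n-k]! k≤n) ⟩
    n ! / (k ! * (n ∸ k) !) * (k ! * (n ∸ k) !) ≡⟨ m/n*n≡m (k![n∸k]!∣n! k≤n) ⟩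
    n !                                 ∎
    where
    open ≡-Reasoning
    instance _ = k !* (n ∸ k) !≢0

  prime∣pCi : ∀ {p i} → Prime p → 0 < i → i < p → p ∣ p C i
  prime∣pCi {p@(suc p-1)} {i} pr 0<i i<p
    with euclidsLemma (p C i) (i ! * (p ∸ i) !) pr
           (subst (p ∣_) (sym (nCk*k![n∸k]!≡n! (<⇒≤ i<p))) (m∣m*n (p-1 !)))
  ... | inj₁ p∣pCi = p∣pCi
  ... | inj₂ p∣i!*[p∸i]! with euclidsLemma (i !) ((p ∸ i) !) pr p∣i!*[p∸i]!
  ...   | inj₁ p∣i! = ⊥-elim (<⇒≱ i<p (prime∣n!⇒prime≤n pr i p∣i!))
  ...   | inj₂ p∣[p∸i]! = ⊥-elim (<⇒≱ (∸-monoʳ-< 0<i (<⇒≤ i<p)) (prime∣n!⇒prime≤n pr (p ∸ i) p∣[p∸i]!))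

-- The ring solver needs a coefficient ring mapping into R; ℤ maps into every ring.
module IntegerCoefficients {c ℓ} (R : CommutativeRing c ℓ) where
  open CommutativeRing R
  open import Data.Nat as ℕ using (zero; suc)
  import Data.Nat.Properties as ℕ
  open import Data.Integer as ℤ using (ℤ; +_; -[1+_]; _⊖_)
  import Data.Integer.Properties as ℤ
  open import Data.Sign as Sign using (Sign)
  open import Data.Maybe using (Maybe; just; nothing)
  open import Relation.Nullary using (yes; no)
  open import Relation.Binary.PropositionalEquality as ≡ using (_≡_)
  open import Algebra.Solver.Ring.AlmostCommutativeRing
  open import Algebra.Properties.Semiring.Mult semiring using (_×_; ×-homo-+; ×1-homo-*)
  open import Algebra.Properties.Ring ring using (-‿involutive; -0#≈0#; -1*x≈-x)
  open import Algebra.Properties.AbelianGroup +-abelianGroup using (⁻¹-∙-comm)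
  module + = Algebra.Properties.CommutativeSemigroup +-commutativeSemigroup
  module * = Algebra.Properties.CommutativeSemigroup *-commutativeSemigroup
  open import Relation.Binary.Reasoning.Setoid setoid

  [a+b]-[a+c]≈b-c : ∀ a b c → (a + b) - (a + c) ≈ b - c
  [a+b]-[a+c]≈b-c a b c = begin
    (a + b) + - (a + c)     ≈⟨ +-congˡ (⁻¹-∙-comm a c) ⟨
    (a + b) + (- a + - c)   ≈⟨ +.interchange a b (- a) (- c) ⟩
    (a + - a) + (b + - c)   ≈⟨ +-congʳ (-‿inverseʳ a) ⟩
    0# + (b - c)            ≈⟨ +-identityˡ _ ⟩
    b - c                   ∎

  fromℤ : ℤ → Carrier
  fromℤ (+ n) = n × 1#
  fromℤ -[1+ n ] = - (suc n × 1#)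

  fromSign : Sign → Carrier
  fromSign Sign.+ = 1#
  fromSign Sign.- = - 1#

  fromℤ-⊖ : ∀ m n → fromℤ (m ⊖ n) ≈ m × 1# - n × 1#
  fromℤ-⊖ zero zero = sym (trans (+-identityˡ _) -0#≈0#)
  fromℤ-⊖ (suc m) zero = sym (trans (+-congˡ -0#≈0#) (+-identityʳ _))
  fromℤ-⊖ zero (suc n) = sym (+-identityˡ _)
  fromℤ-⊖ (suc m) (suc n) = begin
    fromℤ (suc m ⊖ suc n)   ≡⟨ ≡.cong fromℤ (ℤ.[1+m]⊖[1+n]≡m⊖n m n) ⟩
    fromℤ (m ⊖ n)           ≈⟨ fromℤ-⊖ m n ⟩
    m × 1# - n × 1#         ≈⟨ [a+b]-[a+c]≈b-c 1# _ _ ⟨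
    suc m × 1# - suc n × 1# ∎

  fromℤ-neg : ∀ i → fromℤ (ℤ.- i) ≈ - fromℤ i
  fromℤ-neg (+ zero) = sym -0#≈0#
  fromℤ-neg (+ suc n) = refl
  fromℤ-neg -[1+ n ] = sym (-‿involutive _)

  fromℤ-+ : ∀ i j → fromℤ (i ℤ.+ j) ≈ fromℤ i + fromℤ j
  fromℤ-+ (+ m) (+ n) = ×-homo-+ 1# m n
  fromℤ-+ (+ m) -[1+ n ] = fromℤ-⊖ m (suc n)
  fromℤ-+ -[1+ m ] (+ n) = trans (fromℤ-⊖ n (suc m)) (+-comm _ _)
  fromℤ-+ -[1+ m ] -[1+ n ] = begin
    - (suc (suc (m ℕ.+ n)) × 1#) ≡⟨ ≡.cong (λ k → - (k × 1#)) (≡.sym (ℕ.+-suc (suc m) n)) ⟩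
    - ((suc m ℕ.+ suc n) × 1#)   ≈⟨ -‿cong (×-homo-+ 1# (suc m) (suc n)) ⟩
    - (suc m × 1# + suc n × 1#)  ≈⟨ ⁻¹-∙-comm _ _ ⟨
    fromℤ -[1+ m ] + fromℤ -[1+ n ] ∎

  fromℤ-◃ : ∀ s n → fromℤ (s ℤ.◃ n) ≈ fromSign s * (n × 1#)
  fromℤ-◃ s zero = sym (zeroʳ _)
  fromℤ-◃ Sign.+ (suc n) = sym (*-identityˡ _)
  fromℤ-◃ Sign.- (suc n) = sym (-1*x≈-x _)

  fromSign-* : ∀ s t → fromSign (s Sign.* t) ≈ fromSign s * fromSign t
  fromSign-* Sign.+ t = sym (*-identityˡ _)
  fromSign-* Sign.- Sign.+ = sym (*-identityʳ _)
  fromSign-* Sign.- Sign.- = sym (trans (-1*x≈-x _) (-‿involutive _))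

  fromℤ≈sign*abs : ∀ i → fromℤ i ≈ fromSign (ℤ.sign i) * (ℤ.∣ i ∣ × 1#)
  fromℤ≈sign*abs i = begin
    fromℤ i                             ≡⟨ ≡.cong fromℤ (ℤ.◃-inverse i) ⟨
    fromℤ (ℤ.sign i ℤ.◃ ℤ.∣ i ∣)          ≈⟨ fromℤ-◃ (ℤ.sign i) ℤ.∣ i ∣ ⟩
    fromSign (ℤ.sign i) * (ℤ.∣ i ∣ × 1#) ∎

  fromℤ-* : ∀ i j → fromℤ (i ℤ.* j) ≈ fromℤ i * fromℤ j
  fromℤ-* i j = begin
    fromℤ (i ℤ.* j)
      ≈⟨ fromℤ-◃ (ℤ.sign i Sign.* ℤ.sign j) (ℤ.∣ i ∣ ℕ.* ℤ.∣ j ∣) ⟩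
    fromSign (ℤ.sign i Sign.* ℤ.sign j) * ((ℤ.∣ i ∣ ℕ.* ℤ.∣ j ∣) × 1#)
      ≈⟨ *-cong (fromSign-* (ℤ.sign i) (ℤ.sign j)) (×1-homo-* ℤ.∣ i ∣ ℤ.∣ j ∣) ⟩
    (fromSign (ℤ.sign i) * fromSign (ℤ.sign j)) * ((ℤ.∣ i ∣ × 1#) * (ℤ.∣ j ∣ × 1#))
      ≈⟨ *.interchange _ _ _ _ ⟩
    (fromSign (ℤ.sign i) * (ℤ.∣ i ∣ × 1#)) * (fromSign (ℤ.sign j) * (ℤ.∣ j ∣ × 1#))
      ≈⟨ *-cong (fromℤ≈sign*abs i) (fromℤ≈sign*abs j) ⟨
    fromℤ i * fromℤ j ∎

  fromℤ-homomorphism : ℤ.+-*-rawRing -Raw-AlmostCommutative⟶ fromCommutativeRing R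
  fromℤ-homomorphism = record
    { ⟦_⟧ = fromℤ ; +-homo = fromℤ-+ ; *-homo = fromℤ-* ; -‿homo = fromℤ-neg
    ; 0-homo = refl ; 1-homo = +-identityʳ 1# }

  coefficient≟ : ∀ i j → Maybe (fromℤ i ≈ fromℤ j)
  coefficient≟ i j with i ℤ.≟ j
  ... | yes ≡.refl = just refl
  ... | no _ = nothing

  open import Algebra.Solver.Ring ℤ.+-*-rawRing (fromCommutativeRing R) fromℤ-homomorphism coefficient≟ public
    using (solve; _:=_; _:+_; _:*_; _:-_; :-_)

module Exponentiation {c ℓ} (R : CommutativeRing c ℓ) where
  open CommutativeRing R
  open FieldDefs R using (pow)
  open import Data.Nat as ℕ using (zero; suc)
  import Data.Nat.Properties as ℕ
  open import Data.Nat.GCD using (gcd; gcd-GCD; module Bézout)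
  open import Relation.Binary.PropositionalEquality as ≡ using (_≡_)
  open import Relation.Binary.Reasoning.Setoid setoid
  module ℕR = ≡.≡-Reasoning
  open import Algebra.Properties.Semiring.Exp semiring public using (_^_; ^-congˡ; ^-assocʳ)
  open import Algebra.Properties.CommutativeSemiring.Exp commutativeSemiring public using (^-distrib-*)

  pow≡^ : ∀ x k → pow x k ≡ x ^ k
  pow≡^ x zero = ≡.refl
  pow≡^ x (suc k) = ≡.cong (x *_) (pow≡^ x k)

  1#^n≈1# : ∀ n → 1# ^ n ≈ 1#
  1#^n≈1# zero = refl
  1#^n≈1# (suc n) = trans (*-identityˡ _) (1#^n≈1# n)

  x^k≈x⇒x^[k^t]≈x : ∀ {x k} → x ^ k ≈ x → ∀ t → x ^ (k ℕ.^ t) ≈ x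
  x^k≈x⇒x^[k^t]≈x {x} {k} x^k≈x zero = *-identityʳ x
  x^k≈x⇒x^[k^t]≈x {x} {k} x^k≈x (suc t) = begin
    x ^ (k ℕ.* k ℕ.^ t) ≈⟨ ^-assocʳ x k (k ℕ.^ t) ⟨
    (x ^ k) ^ (k ℕ.^ t) ≈⟨ ^-congˡ (k ℕ.^ t) x^k≈x ⟩
    x ^ (k ℕ.^ t)       ≈⟨ x^k≈x⇒x^[k^t]≈x x^k≈x t ⟩
    x                   ∎

  Additive : (Carrier → Carrier) → Set (c ⊔ ℓ)
  Additive f = ∀ x y → f (x + y) ≈ f x + f y

  ^-additive⇒^[k^t]-additive : ∀ {k} → Additive (_^ k) → ∀ t → Additive (_^ (k ℕ.^ t))
  ^-additive⇒^[k^t]-additive _ zero x y = trans (*-identityʳ _) (sym (+-cong (*-identityʳ x) (*-identityʳ y)))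
  ^-additive⇒^[k^t]-additive {k} additive (suc t) x y = begin
    (x + y) ^ (k ℕ.* k ℕ.^ t)             ≈⟨ ^-assocʳ (x + y) k (k ℕ.^ t) ⟨
    ((x + y) ^ k) ^ (k ℕ.^ t)             ≈⟨ ^-congˡ (k ℕ.^ t) (additive x y) ⟩
    (x ^ k + y ^ k) ^ (k ℕ.^ t)           ≈⟨ ^-additive⇒^[k^t]-additive additive t (x ^ k) (y ^ k) ⟩
    (x ^ k) ^ (k ℕ.^ t) + (y ^ k) ^ (k ℕ.^ t) ≈⟨ +-cong (^-assocʳ x k (k ℕ.^ t)) (^-assocʳ y k (k ℕ.^ t)) ⟩
    x ^ (k ℕ.* k ℕ.^ t) + y ^ (k ℕ.* k ℕ.^ t) ∎

  -- Bézout gives 1 + bn = am or 1 + am = bn, so q·(qⁿ)ᵇ = (qᵐ)ᵃ or (qᵐ)ᵃ·q = (qⁿ)ᵇ.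
  fixed-by-coprime-powers : ∀ {x} q m n → gcd m n ≡ 1 → (∀ z → z ^ (q ℕ.^ n) ≈ z) →
                            x ^ (q ℕ.^ m) ≈ x → x ^ q ≈ x
  fixed-by-coprime-powers {x} q m n gcd≡1 fixedⁿ fixedᵐ
    with ≡.subst (λ d → Bézout.Identity d m n) gcd≡1 (Bézout.identity (gcd-GCD m n))
  ... | Bézout.+- a b 1+bn≡am = begin
    x ^ q                       ≈⟨ x^k≈x⇒x^[k^t]≈x (fixedⁿ (x ^ q)) b ⟨
    (x ^ q) ^ ((q ℕ.^ n) ℕ.^ b) ≈⟨ ^-assocʳ x q ((q ℕ.^ n) ℕ.^ b) ⟩
    x ^ (q ℕ.* (q ℕ.^ n) ℕ.^ b) ≡⟨ ≡.cong (x ^_) exponents ⟩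
    x ^ ((q ℕ.^ m) ℕ.^ a)       ≈⟨ x^k≈x⇒x^[k^t]≈x fixedᵐ a ⟩
    x                           ∎
    where
    exponents : q ℕ.* (q ℕ.^ n) ℕ.^ b ≡ (q ℕ.^ m) ℕ.^ a
    exponents = ℕR.begin
      q ℕ.* (q ℕ.^ n) ℕ.^ b ℕR.≡⟨ ≡.cong (q ℕ.*_) (ℕ.^-*-assoc q n b) ⟩
      q ℕ.^ suc (n ℕ.* b)   ℕR.≡⟨ ≡.cong (λ e → q ℕ.^ suc e) (ℕ.*-comm n b) ⟩
      q ℕ.^ suc (b ℕ.* n)   ℕR.≡⟨ ≡.cong (q ℕ.^_) 1+bn≡am ⟩
      q ℕ.^ (a ℕ.* m)       ℕR.≡⟨ ≡.cong (q ℕ.^_) (ℕ.*-comm a m) ⟩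
      q ℕ.^ (m ℕ.* a)       ℕR.≡⟨ ℕ.^-*-assoc q m a ⟨
      (q ℕ.^ m) ℕ.^ a       ℕR.∎
  ... | Bézout.-+ a b 1+am≡bn = begin
    x ^ q                       ≈⟨ ^-congˡ q (x^k≈x⇒x^[k^t]≈x fixedᵐ a) ⟨
    (x ^ ((q ℕ.^ m) ℕ.^ a)) ^ q ≈⟨ ^-assocʳ x ((q ℕ.^ m) ℕ.^ a) q ⟩
    x ^ ((q ℕ.^ m) ℕ.^ a ℕ.* q) ≡⟨ ≡.cong (x ^_) exponents ⟩
    x ^ ((q ℕ.^ n) ℕ.^ b)       ≈⟨ x^k≈x⇒x^[k^t]≈x (fixedⁿ x) b ⟩
    x                           ∎
    where
    exponents : (q ℕ.^ m) ℕ.^ a ℕ.* q ≡ (q ℕ.^ n) ℕ.^ b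
    exponents = ℕR.begin
      (q ℕ.^ m) ℕ.^ a ℕ.* q ℕR.≡⟨ ℕ.*-comm _ q ⟩
      q ℕ.* (q ℕ.^ m) ℕ.^ a ℕR.≡⟨ ≡.cong (q ℕ.*_) (ℕ.^-*-assoc q m a) ⟩
      q ℕ.^ suc (m ℕ.* a)   ℕR.≡⟨ ≡.cong (λ e → q ℕ.^ suc e) (ℕ.*-comm m a) ⟩
      q ℕ.^ suc (a ℕ.* m)   ℕR.≡⟨ ≡.cong (q ℕ.^_) 1+am≡bn ⟩
      q ℕ.^ (b ℕ.* n)       ℕR.≡⟨ ≡.cong (q ℕ.^_) (ℕ.*-comm b n) ⟩
      q ℕ.^ (n ℕ.* b)       ℕR.≡⟨ ℕ.^-*-assoc q n b ⟨
      (q ℕ.^ n) ℕ.^ b       ℕR.∎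

module Characteristic {c ℓ} (R : CommutativeRing c ℓ) where
  open CommutativeRing R
  open Exponentiation R
  open import Data.Nat as ℕ using (suc)
  import Data.Nat.Properties as ℕ
  open import Data.Nat.Divisibility using (_∣_; quotient; m∣n⇒n≡quotient*m)
  open import Data.Nat.Primality using (Prime)
  open import Data.Nat.Combinatorics using (_C_; nCn≡1; nCk≡nC[n∸k])
  open import Data.Fin as Fin using (Fin; toℕ; fromℕ)
  import Data.Fin.Properties as Fin
  open import Data.Vec.Functional using (init; tail; last)
  open import Relation.Binary.PropositionalEquality as ≡ using (_≡_)
  open import Relation.Binary.Reasoning.Setoid setoid
  open import Algebra.Properties.Semiring.Mult semiring using (_×_; ×-congʳ; ×-assoc-*; ×1-homo-*)
  open import Algebra.Properties.Monoid.Sum +-monoid using (sum; sum-cong-≋; sum-init-last; sum-replicate-zero)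
  open PrimeBinomial using (prime∣pCi)

  char∣k⇒k×z≈0# : ∀ {p k} → p × 1# ≈ 0# → p ∣ k → ∀ z → k × z ≈ 0#
  char∣k⇒k×z≈0# {p} {k} char p∣k z = begin
    k × z                          ≈⟨ ×-congʳ k (*-identityˡ z) ⟨
    k × (1# * z)                   ≈⟨ ×-assoc-* k 1# z ⟨
    (k × 1#) * z                   ≡⟨ ≡.cong (λ n → (n × 1#) * z) (m∣n⇒n≡quotient*m p∣k) ⟩
    ((quotient p∣k ℕ.* p) × 1#) * z ≈⟨ *-congʳ (×1-homo-* (quotient p∣k) p) ⟩
    ((quotient p∣k × 1#) * (p × 1#)) * z ≈⟨ *-congʳ (*-congˡ char) ⟩
    ((quotient p∣k × 1#) * 0#) * z ≈⟨ *-congʳ (zeroʳ _) ⟩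
    0# * z                         ≈⟨ zeroˡ z ⟩
    0#                             ∎

  -- (x + y)ᵖ = ∑ (p C i) xⁱ yᵖ⁻ⁱ, and p divides every inner binomial coefficient.
  frobenius-additive : ∀ {p} → Prime p → p × 1# ≈ 0# → Additive (_^ p)
  frobenius-additive {suc p-1} p-prime char x y = begin
    (x + y) ^ p                                  ≈⟨ theorem (*-comm x y) p ⟩
    t Fin.zero + sum (tail t)                    ≈⟨ +-cong first (sum-init-last (tail t)) ⟩
    y ^ p + (sum (init (tail t)) + last (tail t)) ≈⟨ +-congˡ (+-cong inner (lastTerm (fromℕ p) (Fin.toℕ-fromℕ p))) ⟩
    y ^ p + (0# + x ^ p)                         ≈⟨ +-congˡ (+-identityˡ _) ⟩
    y ^ p + x ^ p                                ≈⟨ +-comm _ _ ⟩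
    x ^ p + y ^ p                                ∎
    where
    p = suc p-1
    open import Algebra.Properties.Semiring.Binomial semiring x y using (binomialTerm; theorem)
    t = binomialTerm p
    first : t Fin.zero ≈ y ^ p
    first = begin
      (p C 0) × (1# * y ^ p) ≡⟨ ≡.cong (_× (1# * y ^ p)) (≡.trans (nCk≡nC[n∸k] {0} {p} ℕ.z≤n) (nCn≡1 p)) ⟩
      (1# * y ^ p) + 0#      ≈⟨ +-identityʳ _ ⟩
      1# * y ^ p             ≈⟨ *-identityˡ _ ⟩
      y ^ p                  ∎
    lastTerm : ∀ k → toℕ k ≡ p → t k ≈ x ^ p
    lastTerm k k≡p rewrite k≡p | nCn≡1 p | ℕ.n∸n≡0 p = trans (+-identityʳ _) (*-identityʳ _)
    inner : sum (init (tail t)) ≈ 0#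
    inner = trans (sum-cong-≋ {p-1} (λ j → char∣k⇒k×z≈0# char (prime∣pCi p-prime (ℕ.s≤s ℕ.z≤n) (1+j<p j)) _))
                  (sum-replicate-zero p-1)
      where
      1+j<p : (j : Fin p-1) → suc (toℕ (Fin.inject₁ j)) ℕ.< p
      1+j<p j = ℕ.s≤s (≡.subst (ℕ._< p-1) (≡.sym (Fin.toℕ-inject₁ j)) (Fin.toℕ<n j))

module DecidableField {c ℓ} (R : CommutativeRing c ℓ) (isField : FieldDefs.IsField R)
    (_≟_ : Decidable (CommutativeRing._≈_ R)) where
  open CommutativeRing R
  open Exponentiation R using (_^_)
  open import Data.Nat using (zero; suc)
  open import Data.Product using (proj₁; proj₂)
  open import Relation.Nullary using (¬_; yes; no)
  open import Data.Empty using (⊥-elim)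
  open import Relation.Binary.Reasoning.Setoid setoid

  1#≉0# : ¬ 1# ≈ 0#
  1#≉0# = proj₁ isField

  -- 0⁻¹ is the junk value 0.
  _⁻¹ : Carrier → Carrier
  x ⁻¹ with x ≟ 0#
  ... | yes _ = 0#
  ... | no x≉0 = proj₁ (proj₂ isField x x≉0)

  x*x⁻¹≈1 : ∀ {x} → ¬ x ≈ 0# → x * x ⁻¹ ≈ 1#
  x*x⁻¹≈1 {x} x≉0 with x ≟ 0#
  ... | yes x≈0 = ⊥-elim (x≉0 x≈0)
  ... | no x≉0′ = proj₂ (proj₂ isField x x≉0′)

  x⁻¹*x≈1 : ∀ {x} → ¬ x ≈ 0# → x ⁻¹ * x ≈ 1#
  x⁻¹*x≈1 x≉0 = trans (*-comm _ _) (x*x⁻¹≈1 x≉0)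

  y≈x⁻¹*[xy] : ∀ {x} → ¬ x ≈ 0# → ∀ y → y ≈ x ⁻¹ * (x * y)
  y≈x⁻¹*[xy] {x} x≉0 y = begin
    y               ≈⟨ *-identityˡ y ⟨
    1# * y          ≈⟨ *-congʳ (x⁻¹*x≈1 x≉0) ⟨
    (x ⁻¹ * x) * y  ≈⟨ *-assoc _ _ _ ⟩
    x ⁻¹ * (x * y)  ∎

  *-cancelˡ : ∀ {x y z} → ¬ x ≈ 0# → x * y ≈ x * z → y ≈ z
  *-cancelˡ {x} {y} {z} x≉0 xy≈xz = begin
    y               ≈⟨ y≈x⁻¹*[xy] x≉0 y ⟩
    x ⁻¹ * (x * y)  ≈⟨ *-congˡ xy≈xz ⟩
    x ⁻¹ * (x * z)  ≈⟨ y≈x⁻¹*[xy] x≉0 z ⟨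
    z               ∎

  x*y≈0⇒y≈0 : ∀ {x y} → ¬ x ≈ 0# → x * y ≈ 0# → y ≈ 0#
  x*y≈0⇒y≈0 x≉0 xy≈0 = *-cancelˡ x≉0 (trans xy≈0 (sym (zeroʳ _)))

  *-nonzero : ∀ {x y} → ¬ x ≈ 0# → ¬ y ≈ 0# → ¬ x * y ≈ 0#
  *-nonzero x≉0 y≉0 xy≈0 = y≉0 (x*y≈0⇒y≈0 x≉0 xy≈0)

  x⁻¹≉0 : ∀ {x} → ¬ x ≈ 0# → ¬ x ⁻¹ ≈ 0#
  x⁻¹≉0 x≉0 x⁻¹≈0 = 1#≉0# (trans (sym (x*x⁻¹≈1 x≉0)) (trans (*-congˡ x⁻¹≈0) (zeroʳ _)))

  ^-nonzero : ∀ {x} n → ¬ x ≈ 0# → ¬ x ^ n ≈ 0#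
  ^-nonzero zero _ = 1#≉0#
  ^-nonzero (suc n) x≉0 = *-nonzero x≉0 (^-nonzero n x≉0)

module FiniteField {c ℓ} (R : CommutativeRing c ℓ) (isField : FieldDefs.IsField R)
    (N : ℕ) (card : FieldDefs.HasCardinality R N) where
  open CommutativeRing R
  open Exponentiation R
  open import Data.Nat as ℕ using (zero; suc)
  open import Data.Fin as Fin using (Fin)
  import Data.Fin.Properties as Fin
  open import Data.Fin.Permutation using (Permutation; permutation; _⟨$⟩ʳ_)
  open import Data.Product using (proj₁; proj₂)
  open import Relation.Nullary using (¬_; Dec; yes; no)
  open import Data.Empty using (⊥-elim)
  open import Relation.Binary.PropositionalEquality as ≡ using (_≡_)
  open import Relation.Binary.Reasoning.Setoid setoid
  open import Algebra.Properties.Semiring.Mult semiring using (_×_; ×1-homo-*)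
  open import Algebra.Properties.Group +-group using (identityˡ-unique)
  module Σ = Sum +-commutativeMonoid
  module Π = Sum *-commutativeMonoid

  enum : Fin N → Carrier
  enum = proj₁ card

  enum-injective : ∀ i j → enum i ≈ enum j → i ≡ j
  enum-injective = proj₁ (proj₂ card)

  index : Carrier → Fin N
  index x = proj₁ (proj₂ (proj₂ card) x)

  enum-index : ∀ x → enum (index x) ≈ x
  enum-index x = proj₂ (proj₂ (proj₂ card) x)

  infix 4 _≟_
  _≟_ : Decidable _≈_
  x ≟ y with index x Fin.≟ index y
  ... | yes ix≡iy = yes (trans (sym (enum-index x)) (trans (reflexive (≡.cong enum ix≡iy)) (enum-index y)))
  ... | no ix≢iy = no λ x≈y → ix≢iy (enum-injective _ _ (trans (enum-index x) (trans x≈y (sym (enum-index y)))))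

  open DecidableField R isField _≟_ public

  permutation-from : (φ ψ : Carrier → Carrier) → (∀ {x y} → x ≈ y → φ x ≈ φ y) → (∀ {x y} → x ≈ y → ψ x ≈ ψ y) →
                     (∀ x → φ (ψ x) ≈ x) → (∀ x → ψ (φ x) ≈ x) → Permutation N N
  permutation-from φ ψ φ-cong ψ-cong φψ ψφ = permutation (λ i → index (φ (enum i))) (λ i → index (ψ (enum i)))
    (λ i → enum-injective _ _ (trans (enum-index _) (trans (φ-cong (enum-index _)) (φψ (enum i)))))
    (λ i → enum-injective _ _ (trans (enum-index _) (trans (ψ-cong (enum-index _)) (ψφ (enum i)))))

  translation : Carrier → Permutation N N
  translation x = permutation-from (x +_) (- x +_) +-congˡ +-congˡ
    (λ y → trans (sym (+-assoc _ _ _)) (trans (+-congʳ (-‿inverseʳ x)) (+-identityˡ y)))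
    (λ y → trans (sym (+-assoc _ _ _)) (trans (+-congʳ (-‿inverseˡ x)) (+-identityˡ y)))

  scaling : ∀ {x} → ¬ x ≈ 0# → Permutation N N
  scaling {x} x≉0 = permutation-from (x *_) (x ⁻¹ *_) *-congˡ *-congˡ
    (λ y → trans (sym (*-assoc _ _ _)) (trans (*-congʳ (x*x⁻¹≈1 x≉0)) (*-identityˡ y)))
    (λ y → sym (y≈x⁻¹*[xy] x≉0 y))

  -- Translating by x permutes the elements, so ∑ (x + e) = ∑ e.
  N×x≈0# : ∀ x → N × x ≈ 0#
  N×x≈0# x = identityˡ-unique (N × x) (Σ.sum enum) (begin
    N × x + Σ.sum enum                  ≈⟨ +-congʳ (Σ.sum-replicate N) ⟨
    Σ.sum {N} (λ _ → x) + Σ.sum enum    ≈⟨ Σ.∑-distrib-+ {N} (λ _ → x) enum ⟨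
    Σ.sum (λ i → x + enum i)            ≈⟨ Σ.sum-cong-≋ (λ i → enum-index (x + enum i)) ⟨
    Σ.sum (λ i → enum (translation x ⟨$⟩ʳ i)) ≈⟨ Σ.sum-permute enum (translation x) ⟨
    Σ.sum enum                          ∎)

  zeroToOne : Carrier → Carrier
  zeroToOne y with y ≟ 0#
  ... | yes _ = 1#
  ... | no _ = y

  zeroToOne-zero : ∀ {y} → y ≈ 0# → zeroToOne y ≈ 1#
  zeroToOne-zero {y} y≈0 with y ≟ 0#
  ... | yes _ = refl
  ... | no y≉0 = ⊥-elim (y≉0 y≈0)

  zeroToOne-nonzero : ∀ {y} → ¬ y ≈ 0# → zeroToOne y ≈ y
  zeroToOne-nonzero {y} y≉0 with y ≟ 0#
  ... | yes y≈0 = ⊥-elim (y≉0 y≈0)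
  ... | no _ = refl

  zeroToOne-cong : ∀ {y z} → y ≈ z → zeroToOne y ≈ zeroToOne z
  zeroToOne-cong {y} {z} y≈z = by-cases (z ≟ 0#)
    where
    by-cases : Dec (z ≈ 0#) → zeroToOne y ≈ zeroToOne z
    by-cases (yes z≈0) = trans (zeroToOne-zero (trans y≈z z≈0)) (sym (zeroToOne-zero z≈0))
    by-cases (no z≉0) =
      trans (zeroToOne-nonzero (λ y≈0 → z≉0 (trans (sym y≈z) y≈0))) (trans y≈z (sym (zeroToOne-nonzero z≉0)))

  ∏-nonzero : ∀ {n} (u : Fin n → Carrier) → (∀ j → ¬ u j ≈ 0#) → ¬ Π.sum u ≈ 0#
  ∏-nonzero {zero} u _ = 1#≉0#
  ∏-nonzero {suc n} u u≉0 = *-nonzero (u≉0 Fin.zero) (∏-nonzero (λ j → u (Fin.suc j)) (λ j → u≉0 (Fin.suc j)))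

  ∏-scale : ∀ x {n} (u : Fin n → Carrier) → Π.sum (λ j → x * u j) ≈ x ^ n * Π.sum u
  ∏-scale x {n} u = trans (Π.∑-distrib-+ (λ _ → x) u) (*-congʳ (Π.sum-replicate n))

  -- Scaling by x ≉ 0 permutes the nonzero elements; comparing products (with 0 counted as 1) gives xᴺ⁻¹ = 1.
  x≉0⇒x^[N-1]≈1 : ∀ {x} → ¬ x ≈ 0# → x ^ ℕ.pred N ≈ 1#
  x≉0⇒x^[N-1]≈1 {x} x≉0 = lemma enum (scaling x≉0) (index 0#) (enum-index 0#)
    (λ j ej≈0 → enum-injective j _ (trans ej≈0 (sym (enum-index 0#))))
    (λ i → enum-index (x * enum i))
    where
    lemma : ∀ {m} (t : Fin m → Carrier) (π : Permutation m m) (i₀ : Fin m) → t i₀ ≈ 0# →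
            (∀ j → t j ≈ 0# → j ≡ i₀) → (∀ i → t (π ⟨$⟩ʳ i) ≈ x * t i) → x ^ ℕ.pred m ≈ 1#
    lemma {suc n} t π i₀ ti₀≈0 zero-unique π-scales = sym (*-cancelˡ E≉0 (begin
      E * 1#                                      ≈⟨ *-comm _ _ ⟩
      1# * E                                      ≈⟨ *-cong (zeroToOne-zero ti₀≈0) (Π.sum-cong-≋ λ j → zeroToOne-nonzero (t′≉0 j)) ⟨
      zeroToOne (t i₀) * Π.sum (λ j → zeroToOne (t′ j)) ≈⟨ Π.sum-remove {i = i₀} (λ i → zeroToOne (t i)) ⟨
      Π.sum (λ i → zeroToOne (t i))               ≈⟨ Π.sum-permute (λ i → zeroToOne (t i)) π ⟩
      Π.sum (λ i → zeroToOne (t (π ⟨$⟩ʳ i)))      ≈⟨ Π.sum-cong-≋ (λ i → zeroToOne-cong (π-scales i)) ⟩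
      Π.sum (λ i → zeroToOne (x * t i))           ≈⟨ Π.sum-remove {i = i₀} (λ i → zeroToOne (x * t i)) ⟩
      zeroToOne (x * t i₀) * Π.sum (λ j → zeroToOne (x * t′ j))
        ≈⟨ *-cong (zeroToOne-zero (trans (*-congˡ ti₀≈0) (zeroʳ x))) (Π.sum-cong-≋ λ j → zeroToOne-nonzero (*-nonzero x≉0 (t′≉0 j))) ⟩
      1# * Π.sum (λ j → x * t′ j)                 ≈⟨ *-identityˡ _ ⟩
      Π.sum (λ j → x * t′ j)                      ≈⟨ ∏-scale x t′ ⟩
      x ^ n * E                                   ≈⟨ *-comm _ _ ⟩
      E * x ^ n                                   ∎))
      where
      t′ : Fin n → Carrier
      t′ j = t (Fin.punchIn i₀ j)
      t′≉0 : ∀ j → ¬ t′ j ≈ 0#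
      t′≉0 j t′j≈0 = Fin.punchInᵢ≢i i₀ j (zero-unique _ t′j≈0)
      E = Π.sum t′
      E≉0 : ¬ E ≈ 0#
      E≉0 = ∏-nonzero t′ t′≉0

  x^N≈x : ∀ x → x ^ N ≈ x
  x^N≈x x = trans (x^m≈x*x^[m-1] (index 0#)) (by-cases (x ≟ 0#))
    where
    x^m≈x*x^[m-1] : ∀ {m} → Fin m → x ^ m ≈ x * x ^ ℕ.pred m
    x^m≈x*x^[m-1] {suc m} _ = refl
    by-cases : Dec (x ≈ 0#) → x * x ^ ℕ.pred N ≈ x
    by-cases (yes x≈0) = trans (*-congʳ x≈0) (trans (zeroˡ _) (sym x≈0))
    by-cases (no x≉0) = trans (*-congˡ (x≉0⇒x^[N-1]≈1 x≉0)) (*-identityʳ x)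

  characteristic : ∀ {p k} → N ≡ p ℕ.^ suc k → p × 1# ≈ 0#
  characteristic {p} {k} N≡p^[1+k] with (p × 1#) ≟ 0#
  ... | yes p≈0 = p≈0
  ... | no p≉0 = ⊥-elim (^-nonzero (suc k) p≉0 (begin
    (p × 1#) ^ suc k       ≈⟨ ×1-homo-^ p (suc k) ⟨
    (p ℕ.^ suc k) × 1#     ≡⟨ ≡.cong (_× 1#) N≡p^[1+k] ⟨
    N × 1#                 ≈⟨ N×x≈0# 1# ⟩
    0#                     ∎))
    where
    ×1-homo-^ : ∀ p t → (p ℕ.^ t) × 1# ≈ (p × 1#) ^ t
    ×1-homo-^ p zero = +-identityʳ 1#
    ×1-homo-^ p (suc t) = trans (×1-homo-* p (p ℕ.^ t)) (*-congˡ (×1-homo-^ p t))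

module ProjectiveLine {c ℓ} (R : CommutativeRing c ℓ) (isField : FieldDefs.IsField R)
    (_≟_ : Decidable (CommutativeRing._≈_ R)) where
  open CommutativeRing R
  open FieldDefs R
  open DecidableField R isField _≟_
  open IntegerCoefficients R using (solve; _:=_; _:+_; _:*_; _:-_)
  open import Data.Product using (_,_; proj₁; proj₂) renaming (_×_ to _∧_)
  open import Relation.Nullary using (¬_; Dec; yes; no)
  open import Function using (_$_)
  open import Algebra.Properties.Group +-group using (x∙y⁻¹≈ε⇒x≈y)
  open import Relation.Binary.Reasoning.Setoid setoid

  infix 4 _≋_
  _≋_ : Vec2 → Vec2 → Set ℓ
  (x₁ , x₂) ≋ (y₁ , y₂) = x₁ ≈ y₁ ∧ x₂ ≈ y₂

  ≋-sym : ∀ {X Y} → X ≋ Y → Y ≋ X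
  ≋-sym (e₁ , e₂) = sym e₁ , sym e₂

  ≋-trans : ∀ {X Y Z} → X ≋ Y → Y ≋ Z → X ≋ Z
  ≋-trans (e₁ , e₂) (f₁ , f₂) = trans e₁ f₁ , trans e₂ f₂

  scale : Carrier → Vec2 → Vec2
  scale t (x₁ , x₂) = (t * x₁ , t * x₂)

  samePoint-sym : ∀ {X Y} → SamePoint X Y → SamePoint Y X
  samePoint-sym (t , t≉0 , e₁ , e₂) =
    t ⁻¹ , x⁻¹≉0 t≉0 , trans (y≈x⁻¹*[xy] t≉0 _) (*-congˡ (sym e₁)) , trans (y≈x⁻¹*[xy] t≉0 _) (*-congˡ (sym e₂))

  samePoint-trans : ∀ {X Y Z} → SamePoint X Y → SamePoint Y Z → SamePoint X Z
  samePoint-trans (t , t≉0 , e₁ , e₂) (s , s≉0 , f₁ , f₂) = s * t , *-nonzero s≉0 t≉0 ,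
    trans f₁ (trans (*-congˡ e₁) (sym (*-assoc _ _ _))) , trans f₂ (trans (*-congˡ e₂) (sym (*-assoc _ _ _)))

  samePoint-≋ : ∀ {X Y Z} → SamePoint X Y → Y ≋ Z → SamePoint X Z
  samePoint-≋ (t , t≉0 , e₁ , e₂) (f₁ , f₂) = t , t≉0 , trans (sym f₁) e₁ , trans (sym f₂) e₂

  scaled⇒samePoint : ∀ {X Y} t → NonZeroVec Y → Y ≋ scale t X → SamePoint X Y
  scaled⇒samePoint t Y≉0 (e₁ , e₂) = t , t≉0 , e₁ , e₂
    where
    t≉0 : ¬ t ≈ 0#
    t≉0 t≈0 = Y≉0 (trans e₁ (trans (*-congʳ t≈0) (zeroˡ _)) , trans e₂ (trans (*-congʳ t≈0) (zeroˡ _)))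

  nonzero-≋ : ∀ {X Y} → X ≋ Y → NonZeroVec X → NonZeroVec Y
  nonzero-≋ (e₁ , e₂) X≉0 (y₁≈0 , y₂≈0) = X≉0 (trans e₁ y₁≈0 , trans e₂ y₂≈0)

  nonzero-resp : ∀ {X Y} → SamePoint X Y → NonZeroVec X → NonZeroVec Y
  nonzero-resp (t , t≉0 , e₁ , e₂) X≉0 (y₁≈0 , y₂≈0) =
    X≉0 (x*y≈0⇒y≈0 t≉0 (trans (sym e₁) y₁≈0) , x*y≈0⇒y≈0 t≉0 (trans (sym e₂) y₂≈0))

  samePoint⇒cross : ∀ {x₁ x₂ y₁ y₂} → SamePoint (x₁ , x₂) (y₁ , y₂) → x₁ * y₂ ≈ x₂ * y₁
  samePoint⇒cross {x₁} {x₂} (t , _ , e₁ , e₂) = begin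
    x₁ * _        ≈⟨ *-congˡ e₂ ⟩
    x₁ * (t * x₂) ≈⟨ solve 3 (λ x₁ x₂ t → x₁ :* (t :* x₂) := x₂ :* (t :* x₁)) refl x₁ x₂ t ⟩
    x₂ * (t * x₁) ≈⟨ *-congˡ e₁ ⟨
    x₂ * _        ∎

  cross⇒samePoint : ∀ {x₁ x₂ y₁ y₂} → NonZeroVec (x₁ , x₂) → NonZeroVec (y₁ , y₂) →
                    x₁ * y₂ ≈ x₂ * y₁ → SamePoint (x₁ , x₂) (y₁ , y₂)
  cross⇒samePoint {x₁} {x₂} {y₁} {y₂} X≉0 Y≉0 cross with x₁ ≟ 0#
  ... | no x₁≉0 = scaled⇒samePoint (y₁ * x₁ ⁻¹) Y≉0 $
    sym (trans (*-assoc _ _ _) (trans (*-congˡ (x⁻¹*x≈1 x₁≉0)) (*-identityʳ _))) ,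
    (begin
      y₂                   ≈⟨ y≈x⁻¹*[xy] x₁≉0 y₂ ⟩
      x₁ ⁻¹ * (x₁ * y₂)    ≈⟨ *-congˡ cross ⟩
      x₁ ⁻¹ * (x₂ * y₁)    ≈⟨ solve 3 (λ i x₂ y₁ → i :* (x₂ :* y₁) := y₁ :* i :* x₂) refl (x₁ ⁻¹) x₂ y₁ ⟩
      y₁ * x₁ ⁻¹ * x₂      ∎)
  ... | yes x₁≈0 = scaled⇒samePoint (y₂ * x₂ ⁻¹) Y≉0 $
    trans y₁≈0 (sym (trans (*-congˡ x₁≈0) (zeroʳ _))) ,
    sym (trans (*-assoc _ _ _) (trans (*-congˡ (x⁻¹*x≈1 x₂≉0)) (*-identityʳ _)))
    where
    x₂≉0 : ¬ x₂ ≈ 0#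
    x₂≉0 x₂≈0 = X≉0 (x₁≈0 , x₂≈0)
    y₁≈0 : y₁ ≈ 0#
    y₁≈0 = x*y≈0⇒y≈0 x₂≉0 (trans (sym cross) (trans (*-congʳ x₁≈0) (zeroˡ _)))

  samePoint? : ∀ {X Y} → NonZeroVec X → NonZeroVec Y → Dec (SamePoint X Y)
  samePoint? {X} {Y} X≉0 Y≉0 with (proj₁ X * proj₂ Y) ≟ (proj₂ X * proj₁ Y)
  ... | yes cross = yes (cross⇒samePoint X≉0 Y≉0 cross)
  ... | no ¬cross = no λ X~Y → ¬cross (samePoint⇒cross X~Y)

  columns : Vec2 → Vec2 → Mat2
  columns (p₁ , p₂) (q₁ , q₂) = mat p₁ q₁ p₂ q₂

  det-columns≈0⇒samePoint : ∀ {P Q} → NonZeroVec P → NonZeroVec Q → det (columns P Q) ≈ 0# → SamePoint P Q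
  det-columns≈0⇒samePoint {p₁ , p₂} {q₁ , q₂} P≉0 Q≉0 det≈0 =
    cross⇒samePoint P≉0 Q≉0 (trans (x∙y⁻¹≈ε⇒x≈y _ _ det≈0) (*-comm q₁ p₂))

  apply-scale : ∀ M t Y → apply M (scale t Y) ≋ scale t (apply M Y)
  apply-scale (mat a b c d) t (y₁ , y₂) =
    solve 5 (λ a b t y₁ y₂ → a :* (t :* y₁) :+ b :* (t :* y₂) := t :* (a :* y₁ :+ b :* y₂)) refl a b t y₁ y₂ ,
    solve 5 (λ c d t y₁ y₂ → c :* (t :* y₁) :+ d :* (t :* y₂) := t :* (c :* y₁ :+ d :* y₂)) refl c d t y₁ y₂

  apply-cong : ∀ M {Y Y′} → Y ≋ Y′ → apply M Y ≋ apply M Y′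
  apply-cong (mat a b c d) (e₁ , e₂) = +-cong (*-congˡ e₁) (*-congˡ e₂) , +-cong (*-congˡ e₁) (*-congˡ e₂)

  apply-samePoint : ∀ M {Y Y′} → SamePoint Y Y′ → SamePoint (apply M Y) (apply M Y′)
  apply-samePoint M {Y} (t , t≉0 , Y′≋tY) = t , t≉0 , ≋-trans (apply-cong M Y′≋tY) (apply-scale M t Y)

  apply-columns-zeroˡ : ∀ P Q {w₁ w₂} → w₁ ≈ 0# → apply (columns P Q) (w₁ , w₂) ≋ scale w₂ Q
  apply-columns-zeroˡ (p₁ , p₂) (q₁ , q₂) w₁≈0 = vanish p₁ q₁ , vanish p₂ q₂
    where
    vanish : ∀ p q → p * _ + q * _ ≈ _ * q
    vanish p q = trans (+-congʳ (trans (*-congˡ w₁≈0) (zeroʳ p))) (trans (+-identityˡ _) (*-comm _ _))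

  apply-columns-zeroʳ : ∀ P Q {w₁ w₂} → w₂ ≈ 0# → apply (columns P Q) (w₁ , w₂) ≋ scale w₁ P
  apply-columns-zeroʳ (p₁ , p₂) (q₁ , q₂) w₂≈0 = vanish p₁ q₁ , vanish p₂ q₂
    where
    vanish : ∀ p q → p * _ + q * _ ≈ _ * p
    vanish p q = trans (+-congˡ (trans (*-congˡ w₂≈0) (zeroʳ q))) (trans (+-identityʳ _) (*-comm _ _))

  apply-nonzero⇒nonzero : ∀ M Y → NonZeroVec (apply M Y) → NonZeroVec Y
  apply-nonzero⇒nonzero (mat a b c d) (y₁ , y₂) MY≉0 (y₁≈0 , y₂≈0) = MY≉0 (vanishes a b , vanishes c d)
    where
    vanishes : ∀ u v → u * y₁ + v * y₂ ≈ 0#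
    vanishes u v = trans (+-cong (trans (*-congˡ y₁≈0) (zeroʳ u)) (trans (*-congˡ y₂≈0) (zeroʳ v))) (+-identityʳ 0#)

  -- Cramer's rule.
  coordinates : Mat2 → Vec2 → Vec2
  coordinates M@(mat a b c d) (x₁ , x₂) = ((d * x₁ - b * x₂) * det M ⁻¹ , (a * x₂ - c * x₁) * det M ⁻¹)

  apply-coordinates : ∀ M → ¬ det M ≈ 0# → ∀ X → apply M (coordinates M X) ≋ X
  apply-coordinates M@(mat a b c d) det≉0 (x₁ , x₂) =
    trans (solve 7 (λ a b c d x₁ x₂ i →
                      a :* ((d :* x₁ :- b :* x₂) :* i) :+ b :* ((a :* x₂ :- c :* x₁) :* i) := x₁ :* ((a :* d :- b :* c) :* i))
                   refl a b c d x₁ x₂ (det M ⁻¹))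
          (trans (*-congˡ (x*x⁻¹≈1 det≉0)) (*-identityʳ x₁)) ,
    trans (solve 7 (λ a b c d x₁ x₂ i →
                      c :* ((d :* x₁ :- b :* x₂) :* i) :+ d :* ((a :* x₂ :- c :* x₁) :* i) := x₂ :* ((a :* d :- b :* c) :* i))
                   refl a b c d x₁ x₂ (det M ⁻¹))
          (trans (*-congˡ (x*x⁻¹≈1 det≉0)) (*-identityʳ x₂))

IsEndomorphism : ∀ {c ℓ} (R : CommutativeRing c ℓ) → (CommutativeRing.Carrier R → CommutativeRing.Carrier R) → Set (c ⊔ ℓ)
IsEndomorphism R = SemiringMorphisms.IsSemiringHomomorphism rawSemiring rawSemiring
  where open Semiring (CommutativeRing.semiring R) using (rawSemiring)

module AbsolutePoints {c ℓ} (R : CommutativeRing c ℓ) (isField : FieldDefs.IsField R)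
    (_≟_ : Decidable (CommutativeRing._≈_ R))
    (σ : CommutativeRing.Carrier R → CommutativeRing.Carrier R) (σ-endo : IsEndomorphism R σ)
    (A : FieldDefs.Mat2 R) where
  open CommutativeRing R
  open FieldDefs R
  open DecidableField R isField _≟_
  open ProjectiveLine R isField _≟_
  open IntegerCoefficients R using (solve; _:=_; _:+_; _:*_; _:-_; :-_)
  open SemiringMorphisms.IsSemiringHomomorphism σ-endo
    renaming (⟦⟧-cong to σ-cong; +-homo to σ-+; *-homo to σ-*; 0#-homo to σ-0#; 1#-homo to σ-1#)
  open import Data.Product using (∃; _,_; proj₁; proj₂) renaming (_×_ to _∧_)
  open import Relation.Nullary using (¬_; yes; no)
  open import Data.Empty using (⊥-elim)
  open import Function.Bundles using (_⇔_; mk⇔; Equivalence)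
  open import Algebra.Properties.Group +-group using (x∙y⁻¹≈ε⇒x≈y; x≈y⇒x∙y⁻¹≈ε; inverseʳ-unique)
  open import Algebra.Properties.Ring ring using (-‿distribˡ-*; -0#≈0#)
  open import Relation.Binary.Reasoning.Setoid setoid

  a = Mat2.m11 A
  b = Mat2.m12 A
  c′ = Mat2.m21 A
  d = Mat2.m22 A

  Aᵗ : Mat2
  Aᵗ = mat a c′ b d

  infix 7 _·_
  _·_ : Vec2 → Vec2 → Carrier
  (x₁ , x₂) · (y₁ , y₂) = x₁ * y₁ + x₂ * y₂

  σ⃗ : Vec2 → Vec2
  σ⃗ (x₁ , x₂) = (σ x₁ , σ x₂)

  -- Xᵗ A Y^σ, so that Absolute σ A X is definitionally form X X ≈ 0#.
  form : Vec2 → Vec2 → Carrier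
  form X Y = apply Aᵗ X · σ⃗ Y

  ·-cong : ∀ {X X′ Y Y′} → X ≋ X′ → Y ≋ Y′ → X · Y ≈ X′ · Y′
  ·-cong (e₁ , e₂) (f₁ , f₂) = +-cong (*-cong e₁ f₁) (*-cong e₂ f₂)

  ·-congˡ : ∀ X {Y Y′} → Y ≋ Y′ → X · Y ≈ X · Y′
  ·-congˡ X Y≋Y′ = ·-cong {X = X} (refl , refl) Y≋Y′

  σ⃗-cong : ∀ {X Y} → X ≋ Y → σ⃗ X ≋ σ⃗ Y
  σ⃗-cong (e₁ , e₂) = σ-cong e₁ , σ-cong e₂

  form-cong : ∀ {X X′ Y Y′} → X ≋ X′ → Y ≋ Y′ → form X Y ≈ form X′ Y′
  form-cong X≋X′ Y≋Y′ = ·-cong (apply-cong (mat a c′ b d) X≋X′) (σ⃗-cong Y≋Y′)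

  absolute-≋ : ∀ {X Y} → X ≋ Y → Absolute σ A X → Absolute σ A Y
  absolute-≋ X≋Y absX = trans (sym (form-cong X≋Y X≋Y)) absX

  σ-nonzero : ∀ {x} → ¬ x ≈ 0# → ¬ σ x ≈ 0#
  σ-nonzero {x} x≉0 σx≈0 = 1#≉0# (begin
    1#               ≈⟨ σ-1# ⟨
    σ 1#             ≈⟨ σ-cong (x*x⁻¹≈1 x≉0) ⟨
    σ (x * x ⁻¹)     ≈⟨ σ-* x (x ⁻¹) ⟩
    σ x * σ (x ⁻¹)   ≈⟨ *-congʳ σx≈0 ⟩
    0# * σ (x ⁻¹)    ≈⟨ zeroˡ _ ⟩
    0#               ∎)

  form-scale : ∀ t X → form (scale t X) (scale t X) ≈ (t * σ t) * form X X
  form-scale t (x₁ , x₂) = trans (·-congˡ (apply Aᵗ (scale t (x₁ , x₂))) (σ-* t x₁ , σ-* t x₂))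
    (solve 10 (λ a b c d t x₁ x₂ st s₁ s₂ →
         (a :* (t :* x₁) :+ c :* (t :* x₂)) :* (st :* s₁) :+ (b :* (t :* x₁) :+ d :* (t :* x₂)) :* (st :* s₂)
      := t :* st :* ((a :* x₁ :+ c :* x₂) :* s₁ :+ (b :* x₁ :+ d :* x₂) :* s₂))
      refl a b c′ d t x₁ x₂ (σ t) (σ x₁) (σ x₂))

  Γ-samePoint : ∀ {X Y} → SamePoint X Y → Γ σ A X → Γ σ A Y
  Γ-samePoint {X} {Y} X~Y@(t , _ , Y≋tX) (X≉0 , absX) = nonzero-resp X~Y X≉0 , (begin
    form Y Y                    ≈⟨ form-cong Y≋tX Y≋tX ⟩
    form (scale t X) (scale t X) ≈⟨ form-scale t X ⟩
    (t * σ t) * form X X        ≈⟨ *-congˡ absX ⟩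
    (t * σ t) * 0#              ≈⟨ zeroʳ _ ⟩
    0#                          ∎)

  form-columns : ∀ P Q w₁ w₂ → let X = apply (columns P Q) (w₁ , w₂) in
    form X X ≈ w₁ * σ w₁ * form P P + w₁ * σ w₂ * form P Q + w₂ * σ w₁ * form Q P + w₂ * σ w₂ * form Q Q
  form-columns (p₁ , p₂) (q₁ , q₂) w₁ w₂ =
    trans (·-congˡ (apply Aᵗ (apply (columns (p₁ , p₂) (q₁ , q₂)) (w₁ , w₂))) (σ-linear p₁ w₁ q₁ w₂ , σ-linear p₂ w₁ q₂ w₂))
    (solve 16 (λ a b c d w₁ w₂ p₁ p₂ q₁ q₂ s₁ s₂ sp₁ sp₂ sq₁ sq₂ →
         (a :* (p₁ :* w₁ :+ q₁ :* w₂) :+ c :* (p₂ :* w₁ :+ q₂ :* w₂)) :* (sp₁ :* s₁ :+ sq₁ :* s₂)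
           :+ (b :* (p₁ :* w₁ :+ q₁ :* w₂) :+ d :* (p₂ :* w₁ :+ q₂ :* w₂)) :* (sp₂ :* s₁ :+ sq₂ :* s₂)
      := w₁ :* s₁ :* ((a :* p₁ :+ c :* p₂) :* sp₁ :+ (b :* p₁ :+ d :* p₂) :* sp₂)
           :+ w₁ :* s₂ :* ((a :* p₁ :+ c :* p₂) :* sq₁ :+ (b :* p₁ :+ d :* p₂) :* sq₂)
           :+ w₂ :* s₁ :* ((a :* q₁ :+ c :* q₂) :* sp₁ :+ (b :* q₁ :+ d :* q₂) :* sp₂)
           :+ w₂ :* s₂ :* ((a :* q₁ :+ c :* q₂) :* sq₁ :+ (b :* q₁ :+ d :* q₂) :* sq₂))
      refl a b c′ d w₁ w₂ p₁ p₂ q₁ q₂ (σ w₁) (σ w₂) (σ p₁) (σ p₂) (σ q₁) (σ q₂))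
    where
    σ-linear : ∀ p w p′ w′ → σ (p * w + p′ * w′) ≈ σ p * σ w + σ p′ * σ w′
    σ-linear p w p′ w′ = trans (σ-+ _ _) (+-cong (σ-* p w) (σ-* p′ w′))

  -- Evaluate at (1,0), (0,1) and (x,1).
  totally-isotropic⇒σ≈id : NonZeroMat A → (∀ X → Absolute σ A X) → ∀ x → σ x ≈ x
  totally-isotropic⇒σ≈id A≉0 isotropic = σ≈id
    where
    isotropic′ : ∀ x y {s t} → σ x ≈ s → σ y ≈ t → apply Aᵗ (x , y) · (s , t) ≈ 0#
    isotropic′ x y σx≈s σy≈t =
      trans (·-congˡ (apply Aᵗ (x , y)) (sym σx≈s , sym σy≈t)) (isotropic (x , y))
    u*1+v*0≈u : ∀ u v → u * 1# + v * 0# ≈ u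
    u*1+v*0≈u u v = trans (+-cong (*-identityʳ u) (zeroʳ v)) (+-identityʳ u)
    u*0+v*1≈v : ∀ u v → u * 0# + v * 1# ≈ v
    u*0+v*1≈v u v = trans (+-cong (zeroʳ u) (*-identityʳ v)) (+-identityˡ v)
    a≈0 : a ≈ 0#
    a≈0 = trans (sym (trans (+-cong (*-congʳ (u*1+v*0≈u a c′)) (*-congʳ (u*1+v*0≈u b d))) (u*1+v*0≈u a b)))
                (isotropic′ 1# 0# σ-1# σ-0#)
    d≈0 : d ≈ 0#
    d≈0 = trans (sym (trans (+-cong (*-congʳ (u*0+v*1≈v a c′)) (*-congʳ (u*0+v*1≈v b d))) (u*0+v*1≈v c′ d)))
                (isotropic′ 0# 1# σ-0# σ-1#)
    c*σx+b*x≈0 : ∀ x → c′ * σ x + b * x ≈ 0#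
    c*σx+b*x≈0 x = trans (sym (+-cong (*-congʳ (trans (+-cong (trans (*-congʳ a≈0) (zeroˡ x)) (*-identityʳ c′)) (+-identityˡ c′)))
                                       (trans (*-identityʳ _) (trans (+-congˡ (trans (*-congʳ d≈0) (zeroˡ 1#))) (+-identityʳ _)))))
                         (isotropic′ x 1# refl σ-1#)
    b≈-c : b ≈ - c′
    b≈-c = inverseʳ-unique c′ b (trans (sym (+-cong (trans (*-congˡ σ-1#) (*-identityʳ c′)) (*-identityʳ b))) (c*σx+b*x≈0 1#))
    σ≈id : ∀ x → σ x ≈ x
    σ≈id x with c′ ≟ 0#
    ... | yes c≈0 = ⊥-elim (A≉0 (a≈0 , trans b≈-c (trans (-‿cong c≈0) -0#≈0#) , c≈0 , d≈0))
    ... | no c≉0 = *-cancelˡ c≉0 (x∙y⁻¹≈ε⇒x≈y _ _ (begin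
      c′ * σ x - c′ * x     ≈⟨ +-congˡ (-‿distribˡ-* c′ x) ⟩
      c′ * σ x + - c′ * x   ≈⟨ +-congˡ (*-congʳ b≈-c) ⟨
      c′ * σ x + b * x      ≈⟨ c*σx+b*x≈0 x ⟩
      0#                    ∎))

  Balanced : Vec2 → Set ℓ
  Balanced (w₁ , w₂) = w₁ * σ w₂ ≈ w₂ * σ w₁

  module Subline (q : ℕ) (fixed⇔subfield : ∀ x → σ x ≈ x ⇔ InSubfield q x) where
    σ-fixed⇒subfield : ∀ {x} → σ x ≈ x → InSubfield q x
    σ-fixed⇒subfield = Equivalence.to (fixed⇔subfield _)

    subfield⇒σ-fixed : ∀ {x} → InSubfield q x → σ x ≈ x
    subfield⇒σ-fixed = Equivalence.from (fixed⇔subfield _)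

    -- A balanced W with w₁ ≠ 0 is w₁ · (1, w₂/w₁), and balancedness says σ fixes w₂/w₁.
    balanced⇒subline : ∀ {W} → NonZeroVec W → Balanced W → ∃ λ Y → StdSublineVec q Y ∧ SamePoint Y W
    balanced⇒subline {w₁ , w₂} W≉0 balanced with w₁ ≟ 0#
    ... | yes w₁≈0 = (0# , 1#) , ((λ (_ , 1≈0) → 1#≉0# 1≈0) , σ-fixed⇒subfield σ-0# , σ-fixed⇒subfield σ-1#) ,
      scaled⇒samePoint w₂ W≉0 (trans w₁≈0 (sym (zeroʳ w₂)) , sym (*-identityʳ w₂))
    ... | no w₁≉0 = (1# , z) , ((λ (1≈0 , _) → 1#≉0# 1≈0) , σ-fixed⇒subfield σ-1# , σ-fixed⇒subfield σz≈z) ,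
      scaled⇒samePoint w₁ W≉0 (sym (*-identityʳ w₁) , sym w₁z≈w₂)
      where
      z = w₂ * w₁ ⁻¹
      w₁z≈w₂ : w₁ * z ≈ w₂
      w₁z≈w₂ = trans (solve 3 (λ w₁ w₂ i → w₁ :* (w₂ :* i) := w₂ :* (w₁ :* i)) refl w₁ w₂ (w₁ ⁻¹))
                     (trans (*-congˡ (x*x⁻¹≈1 w₁≉0)) (*-identityʳ w₂))
      σw₁*σ[w₁⁻¹]≈1 : σ w₁ * σ (w₁ ⁻¹) ≈ 1#
      σw₁*σ[w₁⁻¹]≈1 = trans (sym (σ-* w₁ (w₁ ⁻¹))) (trans (σ-cong (x*x⁻¹≈1 w₁≉0)) σ-1#)
      σz≈z : σ z ≈ z
      σz≈z = *-cancelˡ (*-nonzero w₁≉0 (σ-nonzero w₁≉0)) (begin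
        w₁ * σ w₁ * σ z                ≈⟨ *-congˡ (σ-* w₂ (w₁ ⁻¹)) ⟩
        w₁ * σ w₁ * (σ w₂ * σ (w₁ ⁻¹)) ≈⟨ solve 4 (λ w₁ sw₁ sw₂ s → w₁ :* sw₁ :* (sw₂ :* s) := (w₁ :* sw₂) :* (sw₁ :* s))
                                               refl w₁ (σ w₁) (σ w₂) (σ (w₁ ⁻¹)) ⟩
        (w₁ * σ w₂) * (σ w₁ * σ (w₁ ⁻¹)) ≈⟨ *-cong balanced σw₁*σ[w₁⁻¹]≈1 ⟩
        (w₂ * σ w₁) * 1#               ≈⟨ *-congˡ (x*x⁻¹≈1 w₁≉0) ⟨
        (w₂ * σ w₁) * (w₁ * w₁ ⁻¹)     ≈⟨ solve 4 (λ w₁ w₂ sw₁ i → w₂ :* sw₁ :* (w₁ :* i) := w₁ :* sw₁ :* (w₂ :* i))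
                                               refl w₁ w₂ (σ w₁) (w₁ ⁻¹) ⟩
        w₁ * σ w₁ * z                  ∎)

    subline⇒balanced : ∀ {Y} t → StdSublineVec q Y → Balanced (scale t Y)
    subline⇒balanced {y₁ , y₂} t (_ , y₁∈𝔽q , y₂∈𝔽q) = begin
      t * y₁ * σ (t * y₂)  ≈⟨ *-congˡ (trans (σ-* t y₂) (*-congˡ (subfield⇒σ-fixed y₂∈𝔽q))) ⟩
      t * y₁ * (σ t * y₂)  ≈⟨ solve 4 (λ t st y₁ y₂ → t :* y₁ :* (st :* y₂) := t :* y₂ :* (st :* y₁)) refl t (σ t) y₁ y₂ ⟩
      t * y₂ * (σ t * y₁)  ≈⟨ *-congˡ (trans (σ-* t y₁) (*-congˡ (subfield⇒σ-fixed y₁∈𝔽q))) ⟨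
      t * y₂ * σ (t * y₁)  ∎

    balanced-coordinates⇒subline : ∀ M → ¬ det M ≈ 0# → (∀ W → Absolute σ A (apply M W) ⇔ Balanced W) →
                                   IsSubline q (Γ σ A)
    balanced-coordinates⇒subline M det≉0 absolute⇔balanced = M , det≉0 , λ X X≉0 → mk⇔ (to X≉0) (from X≉0)
      where
      to : ∀ {X} → NonZeroVec X → Γ σ A X → ∃ λ Y → StdSublineVec q Y ∧ SamePoint (apply M Y) X
      to {X} X≉0 (_ , absX) =
        let MW≋X = apply-coordinates M det≉0 X
            W≉0 = apply-nonzero⇒nonzero M _ (nonzero-≋ (≋-sym MW≋X) X≉0)
            balanced = Equivalence.to (absolute⇔balanced _) (absolute-≋ (≋-sym MW≋X) absX)
            (Y , Y∈subline , Y~W) = balanced⇒subline W≉0 balanced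
        in Y , Y∈subline , samePoint-≋ (apply-samePoint M Y~W) MW≋X
      from : ∀ {X} → NonZeroVec X → (∃ λ Y → StdSublineVec q Y ∧ SamePoint (apply M Y) X) → Γ σ A X
      from X≉0 (Y , Y∈subline , (t , _ , X≋tMY)) = X≉0 ,
        absolute-≋ (≋-sym (≋-trans X≋tMY (≋-sym (apply-scale M t Y))))
                   (Equivalence.from (absolute⇔balanced (scale t Y)) (subline⇒balanced t Y∈subline))

  -- Rescale P and Q so that S = P′ + Q′; in the basis (P′, Q′) the form reads
  -- w₁ σ(w₂) u + w₂ σ(w₁) v with u + v = 0.
  module ThreePoints (A≉0 : NonZeroMat A) {P Q S} (ΓP : Γ σ A P) (ΓQ : Γ σ A Q) (ΓS : Γ σ A S)
      (P≁Q : ¬ SamePoint P Q) (P≁S : ¬ SamePoint P S) (Q≁S : ¬ SamePoint Q S) where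

    det₀≉0 : ¬ det (columns P Q) ≈ 0#
    det₀≉0 det≈0 = P≁Q (det-columns≈0⇒samePoint (proj₁ ΓP) (proj₁ ΓQ) det≈0)

    r₁ = proj₁ (coordinates (columns P Q) S)
    r₂ = proj₂ (coordinates (columns P Q) S)

    r≋S : apply (columns P Q) (r₁ , r₂) ≋ S
    r≋S = apply-coordinates (columns P Q) det₀≉0 S

    r₁≉0 : ¬ r₁ ≈ 0#
    r₁≉0 r₁≈0 = Q≁S (scaled⇒samePoint r₂ (proj₁ ΓS) (≋-trans (≋-sym r≋S) (apply-columns-zeroˡ P Q r₁≈0)))

    r₂≉0 : ¬ r₂ ≈ 0#
    r₂≉0 r₂≈0 = P≁S (scaled⇒samePoint r₁ (proj₁ ΓS) (≋-trans (≋-sym r≋S) (apply-columns-zeroʳ P Q r₂≈0)))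

    P′ = scale r₁ P
    Q′ = scale r₂ Q
    M = columns P′ Q′

    det≉0 : ¬ det M ≈ 0#
    det≉0 det≈0 = *-nonzero (*-nonzero r₁≉0 r₂≉0) det₀≉0 (trans (sym det-scaled) det≈0)
      where
      det-scaled : det M ≈ (r₁ * r₂) * det (columns P Q)
      det-scaled = solve 6 (λ r₁ r₂ p₁ p₂ q₁ q₂ → (r₁ :* p₁) :* (r₂ :* q₂) :- (r₂ :* q₁) :* (r₁ :* p₂)
                                                := (r₁ :* r₂) :* (p₁ :* q₂ :- q₁ :* p₂))
                           refl r₁ r₂ (proj₁ P) (proj₂ P) (proj₁ Q) (proj₂ Q)

    u = form P′ Q′
    v = form Q′ P′

    form-basis : ∀ W → form (apply M W) (apply M W) ≈ proj₁ W * σ (proj₂ W) * u + proj₂ W * σ (proj₁ W) * v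
    form-basis (w₁ , w₂) = begin
      form (apply M (w₁ , w₂)) (apply M (w₁ , w₂))     ≈⟨ form-columns P′ Q′ w₁ w₂ ⟩
      w₁ * σ w₁ * form P′ P′ + w₁ * σ w₂ * u + w₂ * σ w₁ * v + w₂ * σ w₂ * form Q′ Q′
        ≈⟨ +-cong (+-congʳ (+-congʳ (absolute-scaled w₁ r₁ P (proj₂ ΓP)))) (absolute-scaled w₂ r₂ Q (proj₂ ΓQ)) ⟩
      0# + w₁ * σ w₂ * u + w₂ * σ w₁ * v + 0#           ≈⟨ trans (+-identityʳ _) (+-congʳ (+-identityˡ _)) ⟩
      w₁ * σ w₂ * u + w₂ * σ w₁ * v                     ∎
      where
      absolute-scaled : ∀ w t X → Absolute σ A X → w * σ w * form (scale t X) (scale t X) ≈ 0#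
      absolute-scaled w t X absX = trans (*-congˡ (trans (form-scale t X) (trans (*-congˡ absX) (zeroʳ _)))) (zeroʳ _)

    u+v≈0 : u + v ≈ 0#
    u+v≈0 = begin
      u + v                                 ≈⟨ +-cong (1*σ1*x≈x u) (1*σ1*x≈x v) ⟨
      1# * σ 1# * u + 1# * σ 1# * v          ≈⟨ form-basis (1# , 1#) ⟨
      form (apply M (1# , 1#)) (apply M (1# , 1#)) ≈⟨ form-cong M[1,1]≋S M[1,1]≋S ⟩
      form S S                              ≈⟨ proj₂ ΓS ⟩
      0#                                    ∎
      where
      1*σ1*x≈x : ∀ x → 1# * σ 1# * x ≈ x
      1*σ1*x≈x x = trans (*-congʳ (trans (*-identityˡ _) σ-1#)) (*-identityˡ x)
      M[1,1]≋S : apply M (1# , 1#) ≋ S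
      M[1,1]≋S = ≋-trans (+-cong (trans (*-identityʳ _) (*-comm _ _)) (trans (*-identityʳ _) (*-comm _ _)) ,
                          +-cong (trans (*-identityʳ _) (*-comm _ _)) (trans (*-identityʳ _) (*-comm _ _))) r≋S

    absolute⇔balanced : ∀ W → Absolute σ A (apply M W) ⇔ Balanced W
    absolute⇔balanced W with u ≟ 0#
    ... | yes u≈0 = mk⇔ (λ _ → balanced) (λ _ → every-absolute (apply M W))
      where
      v≈0 : v ≈ 0#
      v≈0 = trans (sym (+-identityˡ v)) (trans (+-congʳ (sym u≈0)) u+v≈0)
      every-absolute : ∀ X → Absolute σ A X
      every-absolute X = absolute-≋ (apply-coordinates M det≉0 X) (begin
        form (apply M (coordinates M X)) (apply M (coordinates M X)) ≈⟨ form-basis (coordinates M X) ⟩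
        _ * u + _ * v                                 ≈⟨ +-cong (*-congˡ u≈0) (*-congˡ v≈0) ⟩
        _ * 0# + _ * 0#                               ≈⟨ trans (+-cong (zeroʳ _) (zeroʳ _)) (+-identityʳ 0#) ⟩
        0#                                            ∎)
      σ≈id = totally-isotropic⇒σ≈id A≉0 every-absolute
      balanced : Balanced W
      balanced = trans (*-congˡ (σ≈id _)) (trans (*-comm _ _) (*-congˡ (sym (σ≈id _))))
    ... | no u≉0 = mk⇔ (λ absMW → x∙y⁻¹≈ε⇒x≈y _ _ (x*y≈0⇒y≈0 u≉0 (trans (*-comm _ _) (trans (sym form≈) absMW))))
                       (λ balanced → trans form≈ (trans (*-comm _ _) (trans (*-congˡ (x≈y⇒x∙y⁻¹≈ε balanced)) (zeroʳ u))))
      where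
      w₁ = proj₁ W
      w₂ = proj₂ W
      form≈ : form (apply M W) (apply M W) ≈ (w₁ * σ w₂ - w₂ * σ w₁) * u
      form≈ = begin
        form (apply M W) (apply M W)    ≈⟨ form-basis W ⟩
        w₁ * σ w₂ * u + w₂ * σ w₁ * v   ≈⟨ +-congˡ (*-congˡ (inverseʳ-unique u v u+v≈0)) ⟩
        w₁ * σ w₂ * u + w₂ * σ w₁ * - u ≈⟨ solve 3 (λ α β u → α :* u :+ β :* (:- u) := (α :- β) :* u) refl (w₁ * σ w₂) (w₂ * σ w₁) u ⟩
        (w₁ * σ w₂ - w₂ * σ w₁) * u     ∎

module Classification {c ℓ} (R : CommutativeRing c ℓ) (isField : FieldDefs.IsField R)
    (N : ℕ) (card : FieldDefs.HasCardinality R N)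
    (σ : CommutativeRing.Carrier R → CommutativeRing.Carrier R) (σ-endo : IsEndomorphism R σ)
    (A : FieldDefs.Mat2 R) where
  open CommutativeRing R hiding (zero)
  open FieldDefs R
  open FiniteField R isField N card
  open ProjectiveLine R isField _≟_
  open AbsolutePoints R isField _≟_ σ σ-endo A
  open import Data.Fin using (Fin; zero; suc)
  open import Data.Fin.Properties using (any?)
  open import Data.Product using (∃; _,_; proj₁) renaming (_×_ to _∧_)
  open import Data.Sum using (_⊎_; inj₁; inj₂; [_,_]′)
  open import Data.Empty using (⊥)
  open import Function.Bundles using (_⇔_)
  open import Relation.Nullary using (¬_; Dec; yes; no; _×-dec_; _⊎-dec_; ¬?)
  open import Relation.Nullary.Decidable using (decidable-stable)
  open IntegerCoefficients R using (solve; _:=_; _:*_)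
  open import Relation.Binary.Reasoning.Setoid setoid

  point : Fin (suc N) → Vec2
  point zero = (1# , 0#)
  point (suc i) = (enum i , 1#)

  point-nonzero : ∀ i → NonZeroVec (point i)
  point-nonzero zero (1≈0 , _) = 1#≉0# 1≈0
  point-nonzero (suc i) (_ , 1≈0) = 1#≉0# 1≈0

  point-covers : ∀ {X} → NonZeroVec X → ∃ λ i → SamePoint (point i) X
  point-covers {x₁ , x₂} X≉0 with x₂ ≟ 0#
  ... | yes x₂≈0 = zero , scaled⇒samePoint x₁ X≉0 (sym (*-identityʳ x₁) , trans x₂≈0 (sym (zeroʳ x₁)))
  ... | no x₂≉0 = suc (index (x₁ * x₂ ⁻¹)) , scaled⇒samePoint x₂ X≉0 (x₁≈x₂*enum , sym (*-identityʳ x₂))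
    where
    x₁≈x₂*enum : x₁ ≈ x₂ * enum (index (x₁ * x₂ ⁻¹))
    x₁≈x₂*enum = sym (begin
      x₂ * enum (index (x₁ * x₂ ⁻¹)) ≈⟨ *-congˡ (enum-index _) ⟩
      x₂ * (x₁ * x₂ ⁻¹)             ≈⟨ solve 3 (λ x₂ x₁ i → x₂ :* (x₁ :* i) := x₁ :* (x₂ :* i)) refl x₂ x₁ (x₂ ⁻¹) ⟩
      x₁ * (x₂ * x₂ ⁻¹)             ≈⟨ *-congˡ (x*x⁻¹≈1 x₂≉0) ⟩
      x₁ * 1#                       ≈⟨ *-identityʳ x₁ ⟩
      x₁                            ∎)

  absolute? : ∀ i → Dec (Γ σ A (point i))
  absolute? i with form (point i) (point i) ≟ 0#
  ... | yes abs = yes (point-nonzero i , abs)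
  ... | no ¬abs = no λ (_ , abs) → ¬abs abs

  search : ∀ {t} (T : Vec2 → Set t) → (∀ {X Y} → SamePoint X Y → T X → T Y) → (∀ i → Dec (T (point i))) →
           (∀ X → Γ σ A X → T X) ⊎ (∃ λ X → Γ σ A X ∧ ¬ T X)
  search T T-resp T? with any? (λ i → absolute? i ×-dec ¬? (T? i))
  ... | yes (i , Γi , ¬Ti) = inj₂ (point i , Γi , ¬Ti)
  ... | no none = inj₁ λ X ΓX →
    let (i , i~X) = point-covers (proj₁ ΓX)
    in T-resp i~X (decidable-stable (T? i) λ ¬Ti → none (i , Γ-samePoint (samePoint-sym i~X) ΓX , ¬Ti))

  classify : NonZeroMat A → (q : ℕ) → (∀ x → σ x ≈ x ⇔ InSubfield q x) →
             IsEmptySet (Γ σ A) ⊎ IsSinglePoint (Γ σ A) ⊎ IsTwoPoints (Γ σ A) ⊎ IsSubline q (Γ σ A)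
  classify A≉0 q fixed⇔subfield with search (λ _ → ⊥) (λ _ ()) (λ _ → no λ ())
  ... | inj₁ empty = inj₁ empty
  ... | inj₂ (P , ΓP , _)
    with search (SamePoint P) (λ X~Y P~X → samePoint-trans P~X X~Y) (λ i → samePoint? (proj₁ ΓP) (point-nonzero i))
  ...   | inj₁ onlyP = inj₂ (inj₁ (P , ΓP , onlyP))
  ...   | inj₂ (Q , ΓQ , P≁Q)
    with search (λ X → SamePoint P X ⊎ SamePoint Q X)
                (λ X~Y → [ (λ P~X → inj₁ (samePoint-trans P~X X~Y)) , (λ Q~X → inj₂ (samePoint-trans Q~X X~Y)) ]′)
                (λ i → samePoint? (proj₁ ΓP) (point-nonzero i) ⊎-dec samePoint? (proj₁ ΓQ) (point-nonzero i))
  ...     | inj₁ onlyPQ = inj₂ (inj₂ (inj₁ (P , Q , ΓP , ΓQ , P≁Q , onlyPQ)))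
  ...     | inj₂ (S , ΓS , P,Q≁S) = inj₂ (inj₂ (inj₂
    (Subline.balanced-coordinates⇒subline q fixed⇔subfield M det≉0 absolute⇔balanced)))
    where open ThreePoints A≉0 ΓP ΓQ ΓS P≁Q (λ P~S → P,Q≁S (inj₁ P~S)) (λ Q~S → P,Q≁S (inj₂ Q~S))

module FrobeniusPower {c ℓ} (R : CommutativeRing c ℓ) (isField : FieldDefs.IsField R)
    {p k n : ℕ} (p-prime : Prime p) (1≤k : 1 ℕ.≤ k) (1≤n : 1 ℕ.≤ n)
    (card : FieldDefs.HasCardinality R ((p ℕ.^ k) ℕ.^ n)) (m : ℕ) where
  open CommutativeRing R
  open FieldDefs R using (pow; InSubfield)
  open Exponentiation R
  open Characteristic R using (frobenius-additive)
  open FiniteField R isField ((p ℕ.^ k) ℕ.^ n) card using (characteristic; x^N≈x)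
  import Data.Nat.Properties as ℕ
  open import Data.Nat.GCD using (gcd)
  open import Data.Nat.Primality using (prime⇒nonZero)
  open import Algebra.Properties.Semiring.Mult semiring using (_×_)
  open import Function.Bundles using (_⇔_; mk⇔)
  open import Relation.Binary.PropositionalEquality as ≡ using (_≡_)
  open import Relation.Binary.Reasoning.Setoid setoid

  q = p ℕ.^ k

  σ : Carrier → Carrier
  σ x = pow x (q ℕ.^ m)

  σ≈^ : ∀ x → σ x ≈ x ^ (q ℕ.^ m)
  σ≈^ x = reflexive (pow≡^ x (q ℕ.^ m))

  p×1#≈0# : p × 1# ≈ 0#
  p×1#≈0# = characteristic {p} {ℕ.pred (k ℕ.* n)} (≡.trans (ℕ.^-*-assoc p k n) (≡.cong (p ℕ.^_) (≡.sym (ℕ.suc-pred (k ℕ.* n)))))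
    where instance _ = ℕ.>-nonZero (ℕ.*-mono-≤ 1≤k 1≤n)

  ^[q^m]-additive : Additive (_^ (q ℕ.^ m))
  ^[q^m]-additive = ≡.subst (λ e → Additive (_^ e)) (≡.sym (ℕ.^-*-assoc p k m))
    (^-additive⇒^[k^t]-additive (frobenius-additive p-prime p×1#≈0#) (k ℕ.* m))

  σ-endo : IsEndomorphism R σ
  σ-endo = record
    { isNearSemiringHomomorphism = record
      { +-isMonoidHomomorphism = record
        { isMagmaHomomorphism = record
          { isRelHomomorphism = record { cong = λ x≈y → trans (σ≈^ _) (trans (^-congˡ (q ℕ.^ m) x≈y) (sym (σ≈^ _))) }
          ; homo = λ x y → trans (σ≈^ _) (trans (^[q^m]-additive x y) (sym (+-cong (σ≈^ x) (σ≈^ y))))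
          }
        ; ε-homo = σ0≈0 (q ℕ.^ m) {{ℕ.m^n≢0 q m}}
        }
      ; *-homo = λ x y → trans (σ≈^ _) (trans (^-distrib-* x y (q ℕ.^ m)) (sym (*-cong (σ≈^ x) (σ≈^ y))))
      }
    ; 1#-homo = trans (σ≈^ 1#) (1#^n≈1# (q ℕ.^ m))
    }
    where
    instance _ = ℕ.m^n≢0 p k {{prime⇒nonZero p-prime}}
    σ0≈0 : ∀ e → .{{ℕ.NonZero e}} → pow 0# e ≈ 0#
    σ0≈0 (suc e) = zeroˡ _

  σ-fixed⇔subfield : gcd m n ≡ 1 → ∀ x → σ x ≈ x ⇔ InSubfield q x
  σ-fixed⇔subfield gcd≡1 x = mk⇔
    (λ σx≈x → trans (reflexive (pow≡^ x q))
                (fixed-by-coprime-powers q m n gcd≡1 x^N≈x (trans (sym (σ≈^ x)) σx≈x)))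
    (λ x^q≈x → trans (σ≈^ x) (x^k≈x⇒x^[k^t]≈x (trans (sym (reflexive (pow≡^ x q))) x^q≈x) m))

open import Data.Nat using (ℕ; _^_; _≤_)
open import Data.Nat.GCD using (gcd)
open import Data.Sum using (_⊎_)
open import Relation.Binary.PropositionalEquality using (_≡_; refl)
open import Data.Product using (_,_)

mainTheorem1 : {c ℓ : Level} (R : CommutativeRing c ℓ) (q n m : ℕ) →
    IsPrimePower q → 1 ≤ n → gcd m n ≡ 1 →
    FieldDefs.IsField R → FieldDefs.HasCardinality R (q ^ n) →
    (A : FieldDefs.Mat2 R) → FieldDefs.NonZeroMat R A →
    let σ = λ x → FieldDefs.pow R x (q ^ m)
        S = FieldDefs.Γ R σ A
    in FieldDefs.IsEmptySet R S ⊎ FieldDefs.IsSinglePoint R S ⊎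
       FieldDefs.IsTwoPoints R S ⊎ FieldDefs.IsSubline R q S
mainTheorem1 R .(p ^ k) n m (p , k , p-prime , 1≤k , refl) 1≤n gcd≡1 isField card A A≉0 =
  Classification.classify R isField ((p ^ k) ^ n) card σ σ-endo A A≉0 (p ^ k) (σ-fixed⇔subfield gcd≡1)
  where open FrobeniusPower R isField p-prime 1≤k 1≤n card m
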